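{- Let $\tilde G=(V,\tilde E)$ be a graph and $\Phi\subseteq V$ such that (1) $V=\bigcup_{v\in\Phi}N_{\tilde G}(v)$, and (2) for all $u,v\in\Phi$ lying in the same connected component of $\tilde G$, $N_{\tilde G}(u)\cap N_{\tilde G}(v)\neq\emptyset$. Then the function $f$ computed by ComputeConnectedComponents$(\tilde G)$ satisfies, for all $u,v\in V$: $f(u)=f(v)$ if and only if $u$ and $v$ lie in the same connected component of $\tilde G$.
   Context: ComputeConnectedComponents$(\tilde G)$ (with anchor set $\Phi$): initialize $f(v)=-1$ for all $v\in V$, $ID=0$, $Q=\Phi$. While $Q\ne\emptyset$: pick any $u\in Q$, set $f(u)=ID$ and $T=\{u\}$; for each $v\in N_{\tilde G}(u)$ in turn: if $f(v)=-1$, set $f(v)=ID$ and $T\leftarrow T\cup\{v\}$; otherwise set $f(v')\leftarrow f(v)$ for all $v'\in T$ and exit this inner loop. Then set $ID\leftarrow ID+1$ and $Q\leftarrow Q\setminus T$. After the while loop, for every $v\in V\setminus\Phi$ with $f(v)=-1$, pick any $u\in\Phi$ adjacent to $v$ in $\tilde G$ and set $f(v)\leftarrow f(u)$. -}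

module Defs where

open import Data.Nat using (ℕ; zero; suc)
open import Data.Integer using (ℤ; +_; -[1+_]; _≟_)
open import Data.Fin using (Fin)
import Data.Fin.Properties as FinP
open import Data.Fin.Subset using (Subset; _∈_; _∉_; _∪_; _─_; ⁅_⁆)
open import Data.Fin.Subset.Properties using (_∈?_)
open import Data.List using (List; []; _∷_)
import Data.List.Membership.Propositional as LMem
open import Data.List.Relation.Unary.Unique.Propositional using (Unique)
open import Data.Product using (Σ; _×_; _,_; ∃)
open import Data.Bool using (if_then_else_)
open import Relation.Nullary using (¬_; yes; no; does)
open import Relation.Binary.PropositionalEquality using (_≡_)
open import Relation.Binary.Construct.Closure.ReflexiveTransitive using (Star)
open import Function.Bundles using (_⇔_)

record Graph (n : ℕ) : Set₁ where
  field
    Adj    : Fin n → Fin n → Set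
    sym    : ∀ {u v} → Adj u v → Adj v u
    irrefl : ∀ {u} → ¬ Adj u u
open Graph public

module _ {n : ℕ} (G : Graph n) where

  _∈N_ : Fin n → Fin n → Set
  v ∈N u = Adj G u v

  SameComponent : Fin n → Fin n → Set
  SameComponent = Star (Adj G)

  -- L lists every vertex of N_G(u) exactly once (an order "in turn")
  Enumerates : Fin n → List (Fin n) → Set
  Enumerates u L = Unique L × (∀ v → (v LMem.∈ L) ⇔ (v ∈N u))

minus1 : ℤ
minus1 = -[1+ 0 ]

update : {n : ℕ} → (Fin n → ℤ) → Fin n → ℤ → (Fin n → ℤ)
update f x c y with FinP._≟_ x y
... | yes _ = c
... | no  _ = f y

-- The inner loop "for each v ∈ N(u) in turn" run on the given enumeration,
-- with current label ID, current f and current T; returns the new (f , T).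
innerLoop : {n : ℕ} → ℤ → (Fin n → ℤ) → Subset n → List (Fin n)
          → (Fin n → ℤ) × Subset n
innerLoop ID f T [] = f , T
innerLoop ID f T (v ∷ vs) with f v ≟ minus1
... | yes _ = innerLoop ID (update f v ID) (T ∪ ⁅ v ⁆) vs
... | no  _ = (λ x → if does (x ∈? T) then f v else f x) , T

-- Possible executions of the while loop:
-- WhileRun G Q f ID g  means that starting from queue Q, labelling f and
-- counter ID, some sequence of admissible choices (which u ∈ Q is picked,
-- in which order N(u) is traversed) ends the while loop with labelling g.
data WhileRun {n : ℕ} (G : Graph n) : Subset n → (Fin n → ℤ) → ℕ → (Fin n → ℤ) → Set where
  stop : ∀ {Q f ID} → (∀ x → x ∉ Q) → WhileRun G Q f ID f
  step : ∀ {Q f ID g} (u : Fin n) (L : List (Fin n)) →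
         u ∈ Q → Enumerates G u L →
         let r = innerLoop (+ ID) (update f u (+ ID)) ⁅ u ⁆ L in
         WhileRun G (Q ─ Data.Product.proj₂ r) (Data.Product.proj₁ r) (suc ID) g →
         WhileRun G Q f ID g

-- The final phase: every v ∉ Φ with f(v) = -1 receives f(u) for some
-- u ∈ Φ adjacent to v; all other values are unchanged.
-- (Labels of Φ-vertices do not change in this phase, so performing the
-- assignments one by one or simultaneously gives the same results.)
FinalPhase : {n : ℕ} → Graph n → Subset n → (Fin n → ℤ) → (Fin n → ℤ) → Set
FinalPhase G Φ f g =
  ∀ v → ((v ∉ Φ) × (f v ≡ minus1) → ∃ λ u → u ∈ Φ × Adj G u v × g v ≡ f u)
      × (¬ ((v ∉ Φ) × (f v ≡ minus1)) → g v ≡ f v)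

Output : {n : ℕ} → Graph n → Subset n → (Fin n → ℤ) → Set
Output {n} G Φ g = Σ (Fin n → ℤ) λ f → WhileRun G Φ (λ _ → minus1) 0 f × FinalPhase G Φ f g

-- The while loop maintains an invariant on the partial labelling f (where f x ≢ -1):
-- two labelled vertices share a label iff they lie in the same component, and every
-- labelled vertex has an anchor in its component whose whole neighbourhood is labelled.
-- When an anchor u is processed and some neighbour v already carries a label, the
-- vertices collected so far are adjacent to u, hence in v's component, and receive
-- f(v). When no neighbour is labelled, the component of u contains no label at all:
-- a labelled x would have a saturated anchor a, and by condition (2) a and u have a
-- common neighbour, which would be both labelled and unlabelled. So the fresh ID is
-- correct. At the end every anchor is labelled, and the final phase copies to each
-- remaining vertex the label of an adjacent anchor.
module Submission where

open import Defs hiding (sym)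
open import Data.Nat using (ℕ; suc; _<_)
open import Data.Nat.Properties using (<-irrefl; m<n⇒m<1+n; n<1+n)
open import Data.Fin using (Fin)
import Data.Fin.Properties as FinP
open import Data.Fin.Subset using (Subset; _∈_; _∉_; _⊆_; _∪_; _─_; ⁅_⁆)
open import Data.Fin.Subset.Properties
  using (_∈?_; x∈⁅x⁆; x∈⁅y⁆⇒x≡y; x∈p∪q⁻; x∈p∪q⁺; x∈p∧x∉q⇒x∈p─q; p─q⊆p)
open import Data.Integer using (ℤ; +_; _≟_)
open import Data.Product using (∃; _×_; _,_; proj₁; proj₂)
open import Data.Sum using (_⊎_; inj₁; inj₂)
open import Data.Empty using (⊥-elim)
open import Data.Bool using (if_then_else_)
open import Data.List using (List; []; _∷_)
open import Data.List.Membership.Propositional using () renaming (_∈_ to _∈ˡ_)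
open import Data.List.Relation.Unary.Any using (Any; here; there; any?)
import Data.List.Relation.Unary.Any as Any
open import Data.List.Relation.Unary.All using (All; []; _∷_)
import Data.List.Relation.Unary.All as All
open import Data.List.Relation.Unary.All.Properties using (¬Any⇒All¬)
open import Data.List.Relation.Unary.AllPairs using (_∷_)
open import Data.List.Relation.Unary.Unique.Propositional using (Unique)
open import Relation.Nullary using (¬_; yes; no; does; contradiction; ¬?)
open import Relation.Nullary.Decidable using (decidable-stable)
open import Relation.Binary.PropositionalEquality
  using (_≡_; _≢_; refl; sym; trans; subst; subst₂)
open import Relation.Binary.Construct.Closure.ReflexiveTransitive using (ε; _◅_; _◅◅_; reverse)
open import Function using (_∘_)
open import Function.Bundles using (_⇔_; mk⇔; Equivalence)

IsLabel : ℤ → Set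
IsLabel z = z ≢ minus1

+-isLabel : ∀ k → IsLabel (+ k)
+-isLabel k ()

module _ {n : ℕ} where

  update-≡ : ∀ (f : Fin n → ℤ) v c → update f v c v ≡ c
  update-≡ f v c with v FinP.≟ v
  ... | yes _   = refl
  ... | no v≢v = contradiction refl v≢v

  update-≢ : ∀ (f : Fin n → ℤ) v {x} c → v ≢ x → update f v c x ≡ f x
  update-≢ f v {x} c v≢x with v FinP.≟ x
  ... | yes v≡x = contradiction v≡x v≢x
  ... | no _    = refl

  Overwrite : Subset n → ℤ → (Fin n → ℤ) → (Fin n → ℤ) → Set
  Overwrite T c f f′ = ∀ x → (x ∈ T → f′ x ≡ c) × (x ∉ T → f′ x ≡ f x)

  overwrite-cases : ∀ {T c f f′} → Overwrite T c f f′ →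
                    ∀ x → (x ∈ T × f′ x ≡ c) ⊎ (x ∉ T × f′ x ≡ f x)
  overwrite-cases {T} ow x with x ∈? T
  ... | yes x∈T = inj₁ (x∈T , proj₁ (ow x) x∈T)
  ... | no  x∉T = inj₂ (x∉T , proj₂ (ow x) x∉T)

  overwrite-isLabel : ∀ {T c f f′ x} → Overwrite T c f f′ → IsLabel c →
                      IsLabel (f x) → IsLabel (f′ x)
  overwrite-isLabel {x = x} ow c-label fx-label with overwrite-cases ow x
  ... | inj₁ (_ , f′x≡c)  = subst IsLabel (sym f′x≡c) c-label
  ... | inj₂ (_ , f′x≡fx) = subst IsLabel (sym f′x≡fx) fx-label

  update-overwrite : ∀ (f : Fin n → ℤ) v c → Overwrite ⁅ v ⁆ c f (update f v c)
  update-overwrite f v c x =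
    (λ x∈v → subst (λ y → update f v c y ≡ c) (sym (x∈⁅y⁆⇒x≡y v x∈v)) (update-≡ f v c)) ,
    (λ x∉v → update-≢ f v c (λ { refl → x∉v (x∈⁅x⁆ v) }))

  overwrite-if : ∀ T c (f : Fin n → ℤ) → Overwrite T c f (λ x → if does (x ∈? T) then c else f x)
  overwrite-if T c f x with x ∈? T
  ... | yes x∈T = (λ _ → refl) , (λ x∉T → contradiction x∈T x∉T)
  ... | no  x∉T = (λ x∈T → contradiction x∈T x∉T) , (λ _ → refl)

  overwrite-∪ : ∀ {T S c f₀ f f′} → Overwrite T c f₀ f → Overwrite S c f f′ →
                Overwrite (T ∪ S) c f₀ f′
  overwrite-∪ {T} {S} owT owS x with x ∈? S
  ... | yes x∈S = (λ _ → proj₁ (owS x) x∈S) , (λ x∉T∪S → contradiction (x∈p∪q⁺ (inj₂ x∈S)) x∉T∪S)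
  ... | no  x∉S =
    (λ x∈T∪S → trans (proj₂ (owS x) x∉S) (proj₁ (owT x) (x∈T x∈T∪S))) ,
    (λ x∉T∪S → trans (proj₂ (owS x) x∉S) (proj₂ (owT x) (x∉T∪S ∘ x∈p∪q⁺ ∘ inj₁)))
    where
    x∈T : x ∈ T ∪ S → x ∈ T
    x∈T x∈T∪S with x∈p∪q⁻ T S x∈T∪S
    ... | inj₁ x∈T = x∈T
    ... | inj₂ x∈S = contradiction x∈S x∉S

  overwrite-⊆ : ∀ {T T′ d c f f₁ f₂} → T ⊆ T′ → Overwrite T d f f₁ → Overwrite T′ c f₁ f₂ →
                Overwrite T′ c f f₂
  overwrite-⊆ T⊆T′ ow₁ ow₂ x =
    proj₁ (ow₂ x) ,
    (λ x∉T′ → trans (proj₂ (ow₂ x) x∉T′) (proj₂ (ow₁ x) (λ x∈T → x∉T′ (T⊆T′ x∈T))))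

  infix 4 _⊆_∪ˡ_
  _⊆_∪ˡ_ : Subset n → Subset n → List (Fin n) → Set
  T′ ⊆ T ∪ˡ L = ∀ {x} → x ∈ T′ → x ∈ T ⊎ x ∈ˡ L

  ⊆∪ˡ-∷ : ∀ {T′ T w ws} → T′ ⊆ T ∪ ⁅ w ⁆ ∪ˡ ws → T′ ⊆ T ∪ˡ w ∷ ws
  ⊆∪ˡ-∷ {T = T} {w} T′⊆ x∈T′ with T′⊆ x∈T′
  ... | inj₂ x∈ws = inj₂ (there x∈ws)
  ... | inj₁ x∈T∪w with x∈p∪q⁻ T ⁅ w ⁆ x∈T∪w
  ...   | inj₁ x∈T = inj₁ x∈T
  ...   | inj₂ x∈w = inj₂ (here (x∈⁅y⁆⇒x≡y w x∈w))

  -- Unique L matters: a vertex visited twice would find its own new label and stop the loop.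
  innerLoop-unlabelled :
    ∀ {c f₀ f T} (L : List (Fin n)) → Unique L → All (λ w → f w ≡ minus1) L →
    Overwrite T c f₀ f →
    let r = innerLoop c f T L in
    Overwrite (proj₂ r) c f₀ (proj₁ r) × (T ⊆ proj₂ r) ×
    (∀ {x} → x ∈ˡ L → x ∈ proj₂ r) × (proj₂ r ⊆ T ∪ˡ L)
  innerLoop-unlabelled [] _ _ ow = ow , (λ x∈T → x∈T) , (λ ()) , inj₁
  innerLoop-unlabelled {c} {f = f} {T} (w ∷ ws) (w∉ws ∷ unique) (fw ∷ unlabelled) ow
    with f w ≟ minus1
  ... | no fw≢-1 = contradiction fw fw≢-1
  ... | yes _
    with innerLoop-unlabelled ws unique
           (All.zipWith (λ (w≢x , fx) → trans (update-≢ f w c w≢x) fx) (w∉ws , unlabelled))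
           (overwrite-∪ ow (update-overwrite f w c))
  ... | ow′ , T∪w⊆T′ , ws⊆T′ , T′⊆ =
    ow′ , (λ x∈T → T∪w⊆T′ (x∈p∪q⁺ (inj₁ x∈T))) , L⊆T′ , ⊆∪ˡ-∷ T′⊆
    where
    L⊆T′ : ∀ {x} → x ∈ˡ w ∷ ws → x ∈ proj₂ (innerLoop c (update f w c) (T ∪ ⁅ w ⁆) ws)
    L⊆T′ (here refl)  = T∪w⊆T′ (x∈p∪q⁺ (inj₂ (x∈⁅x⁆ w)))
    L⊆T′ (there x∈ws) = ws⊆T′ x∈ws

  innerLoop-labelled :
    ∀ {c f T} (L : List (Fin n)) → Unique L → Any (λ w → IsLabel (f w)) L →
    let r = innerLoop c f T L in
    ∃ λ v → v ∈ˡ L × IsLabel (f v) ×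
      Overwrite (proj₂ r) (f v) f (proj₁ r) × (T ⊆ proj₂ r) × (proj₂ r ⊆ T ∪ˡ L)
  innerLoop-labelled {c} {f} {T} (w ∷ ws) (w∉ws ∷ unique) labelled with f w ≟ minus1
  ... | no fw-label = w , here refl , fw-label , overwrite-if T (f w) f , (λ x∈T → x∈T) , inj₁
  ... | yes fw with labelled
  ...   | here fw-label = contradiction fw fw-label
  ...   | there labelled-ws
    with innerLoop-labelled ws unique (Any.map keeps-label labelled-ws)
    where
    keeps-label : ∀ {x} → IsLabel (f x) → IsLabel (update f w c x)
    keeps-label {x} fx-label =
      subst IsLabel (sym (update-≢ f w c (λ { refl → fx-label fw }))) fx-label
  ...   | v , v∈ws , f₁v-label , ow , T∪w⊆T′ , T′⊆ =
    v , there v∈ws , subst IsLabel f₁v≡fv f₁v-label ,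
    subst (λ d → Overwrite _ d f _) f₁v≡fv
      (overwrite-⊆ (λ x∈w → T∪w⊆T′ (x∈p∪q⁺ (inj₂ x∈w))) (update-overwrite f w c) ow) ,
    (λ x∈T → T∪w⊆T′ (x∈p∪q⁺ (inj₁ x∈T))) , ⊆∪ˡ-∷ T′⊆
    where
    f₁v≡fv : update f w c v ≡ f v
    f₁v≡fv = update-≢ f w c (All.lookup w∉ws v∈ws)

  any-labelled-or-all-unlabelled : ∀ (f : Fin n → ℤ) L →
    Any (λ w → IsLabel (f w)) L ⊎ All (λ w → f w ≡ minus1) L
  any-labelled-or-all-unlabelled f L with any? (λ w → ¬? (f w ≟ minus1)) L
  ... | yes labelled  = inj₁ labelled
  ... | no ¬labelled = inj₂ (All.map (decidable-stable (_ ≟ _)) (¬Any⇒All¬ L ¬labelled))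

module _ {n : ℕ} (G : Graph n) where

  same-sym : ∀ {x y} → SameComponent G x y → SameComponent G y x
  same-sym = reverse (Graph.sym G)

  closedNeighbourhood-sameComponent : ∀ {u L T′} → Enumerates G u L → T′ ⊆ ⁅ u ⁆ ∪ˡ L →
    ∀ {x} → x ∈ T′ → SameComponent G u x
  closedNeighbourhood-sameComponent {u} (_ , enum) T′⊆ x∈T′ with T′⊆ x∈T′
  ... | inj₁ x∈u = subst (SameComponent G u) (sym (x∈⁅y⁆⇒x≡y u x∈u)) ε
  ... | inj₂ x∈L = Equivalence.to (enum _) x∈L ◅ ε

  Consistent : (Fin n → ℤ) → Set
  Consistent f = ∀ {x y} → IsLabel (f x) → IsLabel (f y) → (f x ≡ f y) ⇔ SameComponent G x y

  consistent-by-representatives : ∀ {f h} → Consistent f →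
    (∀ {x} → IsLabel (h x) → ∃ λ y → h x ≡ f y × SameComponent G x y) → Consistent h
  consistent-by-representatives {f} cons rep hx-label hy-label
    with rep hx-label | rep hy-label
  ... | x′ , hx≡fx′ , x~x′ | y′ , hy≡fy′ , y~y′ =
    mk⇔ (λ hx≡hy → x~x′ ◅◅ Equivalence.to same (trans (sym hx≡fx′) (trans hx≡hy hy≡fy′))
                      ◅◅ same-sym y~y′)
        (λ x~y → trans hx≡fx′ (trans (Equivalence.from same (same-sym x~x′ ◅◅ x~y ◅◅ y~y′))
                                     (sym hy≡fy′)))
    where
    same = cons (subst IsLabel hx≡fx′ hx-label) (subst IsLabel hy≡fy′ hy-label)

  consistent-fresh : ∀ {T c f f′ u} → Consistent f → Overwrite T c f f′ →
    (∀ {y} → IsLabel (f y) → c ≢ f y) →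
    (∀ {x} → x ∈ T → SameComponent G u x) →
    (∀ {y} → SameComponent G u y → f y ≡ minus1) →
    Consistent f′
  consistent-fresh {T} {c} {f} {f′} cons ow fresh near-u blank = consistent
    where
    separated : ∀ {s t} → s ∈ T → f′ s ≡ c → f′ t ≡ f t → IsLabel (f′ t) →
                ¬ (f′ s ≡ f′ t) × ¬ SameComponent G s t
    separated s∈T f′s≡c f′t≡ft f′t-label =
      (λ e → fresh ft-label (trans (sym f′s≡c) (trans e f′t≡ft))) ,
      (λ s~t → ft-label (blank (near-u s∈T ◅◅ s~t)))
      where
      ft-label = subst IsLabel f′t≡ft f′t-label

    consistent : Consistent f′
    consistent {x} {y} f′x-label f′y-label with overwrite-cases ow x | overwrite-cases ow y
    ... | inj₁ (x∈T , f′x≡c) | inj₁ (y∈T , f′y≡c) =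
      mk⇔ (λ _ → same-sym (near-u x∈T) ◅◅ near-u y∈T) (λ _ → trans f′x≡c (sym f′y≡c))
    ... | inj₁ (x∈T , f′x≡c) | inj₂ (_ , f′y≡fy) =
      mk⇔ (⊥-elim ∘ proj₁ (separated x∈T f′x≡c f′y≡fy f′y-label))
          (⊥-elim ∘ proj₂ (separated x∈T f′x≡c f′y≡fy f′y-label))
    ... | inj₂ (_ , f′x≡fx) | inj₁ (y∈T , f′y≡c) =
      mk⇔ (⊥-elim ∘ proj₁ (separated y∈T f′y≡c f′x≡fx f′x-label) ∘ sym)
          (⊥-elim ∘ proj₂ (separated y∈T f′y≡c f′x≡fx f′x-label) ∘ same-sym)
    ... | inj₂ (_ , f′x≡fx) | inj₂ (_ , f′y≡fy) =
      subst₂ (λ a b → (a ≡ b) ⇔ SameComponent G x y) (sym f′x≡fx) (sym f′y≡fy)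
        (cons (subst IsLabel f′x≡fx f′x-label) (subst IsLabel f′y≡fy f′y-label))

module Run {n : ℕ} (G : Graph n) (Φ : Subset n)
  (anchors-meet : ∀ u v → u ∈ Φ → v ∈ Φ → SameComponent G u v →
                  ∃ λ w → _∈N_ G w u × _∈N_ G w v) where

  Saturated : (Fin n → ℤ) → Fin n → Set
  Saturated f a = ∀ {w} → Adj G a w → IsLabel (f w)

  record Invariant (Q : Subset n) (f : Fin n → ℤ) (next : ℕ) : Set where
    field
      queue⊆anchors     : Q ⊆ Φ
      dequeued-labelled : ∀ {x} → x ∈ Φ → x ∉ Q → IsLabel (f x)
      labels-below-next : ∀ {x} → IsLabel (f x) → ∃ λ k → k < next × f x ≡ + k
      consistent        : Consistent G f
      saturated-anchor  : ∀ {x} → IsLabel (f x) →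
                          ∃ λ a → a ∈ Φ × SameComponent G x a × Saturated f a
  open Invariant

  invariant-initial : Invariant Φ (λ _ → minus1) 0
  invariant-initial = record
    { queue⊆anchors     = λ x∈Φ → x∈Φ
    ; dequeued-labelled = λ x∈Φ x∉Φ → contradiction x∈Φ x∉Φ
    ; labels-below-next = λ -1-label → contradiction refl -1-label
    ; consistent        = λ -1-label → contradiction refl -1-label
    ; saturated-anchor  = λ -1-label → contradiction refl -1-label
    }

  next-fresh : ∀ {Q f next y} → Invariant Q f next → IsLabel (f y) → + next ≢ f y
  next-fresh inv fy-label next≡fy with labels-below-next inv fy-label
  ... | k , k<next , fy≡k with trans next≡fy fy≡k
  ...   | refl = <-irrefl refl k<next

  component-unlabelled : ∀ {Q f next u y} → Invariant Q f next → u ∈ Φ →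
    (∀ {w} → Adj G u w → f w ≡ minus1) → SameComponent G u y → f y ≡ minus1
  component-unlabelled {f = f} {y = y} inv u∈Φ N[u]-unlabelled u~y with f y ≟ minus1
  ... | yes fy≡-1  = fy≡-1
  ... | no fy-label with saturated-anchor inv fy-label
  ...   | a , a∈Φ , y~a , a-saturated with anchors-meet _ a u∈Φ a∈Φ (u~y ◅◅ y~a)
  ...     | w , uw , aw = contradiction (N[u]-unlabelled uw) (a-saturated aw)

  invariant-overwrite : ∀ {Q f next T c f′} → Invariant Q f next → Overwrite T c f f′ →
    (∃ λ k → k < suc next × c ≡ + k) → Consistent G f′ →
    (∀ {x} → x ∈ T → ∃ λ a → a ∈ Φ × SameComponent G x a × Saturated f′ a) →
    Invariant (Q ─ T) f′ (suc next)
  invariant-overwrite {Q} {f} {next} {T} {c} {f′} inv ow (k , k<1+next , c≡k) cons T-anchored =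
    record
    { queue⊆anchors     = queue⊆anchors inv ∘ p─q⊆p Q T
    ; dequeued-labelled = dequeued
    ; labels-below-next = below
    ; consistent        = cons
    ; saturated-anchor  = anchored
    }
    where
    c-label : IsLabel c
    c-label = subst IsLabel (sym c≡k) (+-isLabel k)

    dequeued : ∀ {x} → x ∈ Φ → x ∉ Q ─ T → IsLabel (f′ x)
    dequeued {x} x∈Φ x∉Q─T with overwrite-cases ow x
    ... | inj₁ (_ , f′x≡c)     = subst IsLabel (sym f′x≡c) c-label
    ... | inj₂ (x∉T , f′x≡fx) =
      subst IsLabel (sym f′x≡fx)
        (dequeued-labelled inv x∈Φ (λ x∈Q → x∉Q─T (x∈p∧x∉q⇒x∈p─q x∈Q x∉T)))

    below : ∀ {x} → IsLabel (f′ x) → ∃ λ k → k < suc next × f′ x ≡ + k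
    below {x} f′x-label with overwrite-cases ow x
    ... | inj₁ (_ , f′x≡c)    = k , k<1+next , trans f′x≡c c≡k
    ... | inj₂ (_ , f′x≡fx) with labels-below-next inv (subst IsLabel f′x≡fx f′x-label)
    ...   | j , j<next , fx≡j = j , m<n⇒m<1+n j<next , trans f′x≡fx fx≡j

    anchored : ∀ {x} → IsLabel (f′ x) → ∃ λ a → a ∈ Φ × SameComponent G x a × Saturated f′ a
    anchored {x} f′x-label with overwrite-cases ow x
    ... | inj₁ (x∈T , _)     = T-anchored x∈T
    ... | inj₂ (_ , f′x≡fx) with saturated-anchor inv (subst IsLabel f′x≡fx f′x-label)
    ...   | a , a∈Φ , x~a , a-saturated =
      a , a∈Φ , x~a , λ aw → overwrite-isLabel ow c-label (a-saturated aw)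

  step-joins : ∀ {Q f next} u L → Enumerates G u L → Invariant Q f next →
    Any (λ w → IsLabel (update f u (+ next) w)) L →
    let r = innerLoop (+ next) (update f u (+ next)) ⁅ u ⁆ L in
    Invariant (Q ─ proj₂ r) (proj₁ r) (suc next)
  step-joins {Q} {f} {next} u L enumerates@(unique , enum) inv labelled
    with innerLoop-labelled {c = + next} {T = ⁅ u ⁆} L unique labelled
  ... | v , v∈L , f₀v-label , ow₀ , u⊆T′ , T′⊆ =
    invariant-overwrite inv ow below (consistent-by-representatives G (consistent inv) rep) anchored
    where
    r = innerLoop (+ next) (update f u (+ next)) ⁅ u ⁆ L

    uv : Adj G u v
    uv = Equivalence.to (enum v) v∈L

    f₀v≡fv : update f u (+ next) v ≡ f v
    f₀v≡fv = update-≢ f u (+ next) (λ { refl → Graph.irrefl G uv })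

    fv-label : IsLabel (f v)
    fv-label = subst IsLabel f₀v≡fv f₀v-label

    ow : Overwrite (proj₂ r) (f v) f (proj₁ r)
    ow = subst (λ d → Overwrite (proj₂ r) d f (proj₁ r)) f₀v≡fv
           (overwrite-⊆ u⊆T′ (update-overwrite f u (+ next)) ow₀)

    near-v : ∀ {x} → x ∈ proj₂ r → SameComponent G x v
    near-v x∈T′ = same-sym G (closedNeighbourhood-sameComponent G enumerates T′⊆ x∈T′) ◅◅ (uv ◅ ε)

    below : ∃ λ k → k < suc next × f v ≡ + k
    below with labels-below-next inv fv-label
    ... | k , k<next , fv≡k = k , m<n⇒m<1+n k<next , fv≡k

    rep : ∀ {x} → IsLabel (proj₁ r x) → ∃ λ y → proj₁ r x ≡ f y × SameComponent G x y
    rep {x} _ with overwrite-cases ow x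
    ... | inj₁ (x∈T′ , f′x≡fv) = v , f′x≡fv , near-v x∈T′
    ... | inj₂ (_ , f′x≡fx)    = x , f′x≡fx , ε

    anchored : ∀ {x} → x ∈ proj₂ r →
               ∃ λ a → a ∈ Φ × SameComponent G x a × Saturated (proj₁ r) a
    anchored x∈T′ with saturated-anchor inv fv-label
    ... | a , a∈Φ , v~a , a-saturated =
      a , a∈Φ , near-v x∈T′ ◅◅ v~a , λ aw → overwrite-isLabel ow fv-label (a-saturated aw)

  step-fresh : ∀ {Q f next} u L → u ∈ Q → Enumerates G u L → Invariant Q f next →
    All (λ w → update f u (+ next) w ≡ minus1) L →
    let r = innerLoop (+ next) (update f u (+ next)) ⁅ u ⁆ L in
    Invariant (Q ─ proj₂ r) (proj₁ r) (suc next)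
  step-fresh {Q} {f} {next} u L u∈Q enumerates@(unique , enum) inv unlabelled
    with innerLoop-unlabelled L unique unlabelled (update-overwrite f u (+ next))
  ... | ow , _ , L⊆T′ , T′⊆ =
    invariant-overwrite inv ow (next , n<1+n next , refl)
      (consistent-fresh G (consistent inv) ow (next-fresh inv) near-u
        (component-unlabelled inv u∈Φ N[u]-unlabelled))
      (λ x∈T′ → u , u∈Φ , same-sym G (near-u x∈T′) , u-saturated)
    where
    r = innerLoop (+ next) (update f u (+ next)) ⁅ u ⁆ L

    u∈Φ : u ∈ Φ
    u∈Φ = queue⊆anchors inv u∈Q

    N[u]-unlabelled : ∀ {w} → Adj G u w → f w ≡ minus1
    N[u]-unlabelled uw =
      trans (sym (update-≢ f u (+ next) (λ { refl → Graph.irrefl G uw })))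
            (All.lookup unlabelled (Equivalence.from (enum _) uw))

    near-u : ∀ {x} → x ∈ proj₂ r → SameComponent G u x
    near-u = closedNeighbourhood-sameComponent G enumerates T′⊆

    u-saturated : Saturated (proj₁ r) u
    u-saturated uw =
      subst IsLabel (sym (proj₁ (ow _) (L⊆T′ (Equivalence.from (enum _) uw)))) (+-isLabel next)

  invariant-step : ∀ {Q f next} u L → u ∈ Q → Enumerates G u L → Invariant Q f next →
    let r = innerLoop (+ next) (update f u (+ next)) ⁅ u ⁆ L in
    Invariant (Q ─ proj₂ r) (proj₁ r) (suc next)
  invariant-step {f = f} {next} u L u∈Q enumerates inv
    with any-labelled-or-all-unlabelled (update f u (+ next)) L
  ... | inj₁ labelled   = step-joins u L enumerates inv labelled
  ... | inj₂ unlabelled = step-fresh u L u∈Q enumerates inv unlabelled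

  whileRun-sound : ∀ {Q f next g} → WhileRun G Q f next g → Invariant Q f next →
    Consistent G g × (∀ {x} → x ∈ Φ → IsLabel (g x))
  whileRun-sound (stop Q-empty) inv =
    consistent inv , λ x∈Φ → dequeued-labelled inv x∈Φ (Q-empty _)
  whileRun-sound (step u L u∈Q enumerates run) inv =
    whileRun-sound run (invariant-step u L u∈Q enumerates inv)

  finalPhase-representative : ∀ {f g} → (∀ {x} → x ∈ Φ → IsLabel (f x)) → FinalPhase G Φ f g →
    ∀ x → ∃ λ y → g x ≡ f y × SameComponent G x y × IsLabel (f y)
  finalPhase-representative {f} Φ-labelled final x with f x ≟ minus1
  ... | no fx-label = x , proj₂ (final x) (fx-label ∘ proj₂) , ε , fx-label
  ... | yes fx≡-1 with proj₁ (final x) ((λ x∈Φ → Φ-labelled x∈Φ fx≡-1) , fx≡-1)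
  ...   | y , y∈Φ , yx , gx≡fy = y , gx≡fy , Graph.sym G yx ◅ ε , Φ-labelled y∈Φ

  output-sound : ∀ {g} → Output G Φ g → Consistent G g × (∀ x → IsLabel (g x))
  output-sound {g} (f , run , final) with whileRun-sound run invariant-initial
  ... | f-consistent , Φ-labelled =
    consistent-by-representatives G f-consistent (λ _ → from-f _) , labelled
    where
    rep : ∀ x → ∃ λ y → g x ≡ f y × SameComponent G x y × IsLabel (f y)
    rep = finalPhase-representative Φ-labelled final

    from-f : ∀ x → ∃ λ y → g x ≡ f y × SameComponent G x y
    from-f x with rep x
    ... | y , gx≡fy , x~y , _ = y , gx≡fy , x~y

    labelled : ∀ x → IsLabel (g x)
    labelled x with rep x
    ... | _ , gx≡fy , _ , fy-label = subst IsLabel (sym gx≡fy) fy-label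

-- Condition (1) only guarantees that the final phase can be carried out; every
-- output of the algorithm is correct without it.
mainTheorem6 : {n : ℕ} (G : Graph n) (Φ : Subset n) →
    (∀ v → ∃ λ u → u ∈ Φ × _∈N_ G v u) →
    (∀ u v → u ∈ Φ → v ∈ Φ → SameComponent G u v →
      ∃ λ w → _∈N_ G w u × _∈N_ G w v) →
    (g : Fin n → ℤ) → Output G Φ g →
    ∀ u v → (g u ≡ g v) ⇔ SameComponent G u v
mainTheorem6 G Φ _ anchors-meet g output u v with Run.output-sound G Φ anchors-meet output
... | consistent , labelled = consistent (labelled u) (labelled v)
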